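{- Let $G$ be a connected graph. Then $\mathrm{id}^{\leq 3}(G) \leq \left\lceil \frac{|E(G)| + \tau_3(G)}{2}\right\rceil$.
   Context: All graphs are finite and simple. A triangle-transversal of $G$ is a set $F$ of edges such that $G\setminus F$ contains no triangle; $\tau_3(G)$ is the minimum size of a triangle-transversal. In an oriented graph, the inversion of a vertex set $X$ reverses the orientation of every arc with both endvertices in $X$; a $(\leq p)$-inversion is the inversion of a set of at most $p$ vertices. For a graph $G$ with labelled vertices, $\mathrm{id}^{\leq p}(G)$ is the maximum, over all pairs of orientations $\vec G_1,\vec G_2$ of $G$, of the minimum number of $(\leq p)$-inversions transforming $\vec G_1$ into $\vec G_2$. -}

module Defs where

open import Data.Nat using (ℕ; zero; suc; _+_; _≤_; _<ᵇ_; ⌈_/2⌉)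
open import Data.Fin using (Fin; toℕ)
open import Data.Fin.Subset using (Subset; ∣_∣)
open import Data.Bool using (Bool; true; false; _∧_; not; if_then_else_)
open import Data.Vec using (lookup)
open import Data.List using (List; []; _∷_; length; filter; cartesianProduct; allFin; foldl)
open import Data.Product using (_×_; _,_; Σ; ∃)
open import Data.Empty using (⊥)
open import Relation.Nullary using (¬_)
open import Relation.Binary.PropositionalEquality using (_≡_; _≢_)
open import Data.Bool.Properties using (T?)

record Graph (n : ℕ) : Set where
  field
    adj    : Fin n → Fin n → Bool
    sym    : ∀ u v → adj u v ≡ adj v u
    irrefl : ∀ u → adj u u ≡ false
open Graph public

countPairs : ∀ {n} → (Fin n → Fin n → Bool) → ℕ
countPairs {n} f =
  length (filter (λ p → T? ((toℕ (Data.Product.proj₁ p) <ᵇ toℕ (Data.Product.proj₂ p))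
                             ∧ f (Data.Product.proj₁ p) (Data.Product.proj₂ p)))
                 (cartesianProduct (allFin n) (allFin n)))

numEdges : ∀ {n} → Graph n → ℕ
numEdges G = countPairs (adj G)

data Reach {n} (G : Graph n) (u : Fin n) : Fin n → Set where
  here : Reach G u u
  step : ∀ {v w} → Reach G u v → adj G v w ≡ true → Reach G u w

Connected : ∀ {n} → Graph n → Set
Connected {n} G = ∀ (u v : Fin n) → Reach G u v

record EdgeSet {n} (G : Graph n) : Set where
  field
    mem  : Fin n → Fin n → Bool
    sym  : ∀ u v → mem u v ≡ mem v u
    sub  : ∀ u v → mem u v ≡ true → adj G u v ≡ true
open EdgeSet public

esize : ∀ {n} {G : Graph n} → EdgeSet G → ℕ
esize F = countPairs (mem F)

adjMinus : ∀ {n} (G : Graph n) → EdgeSet G → Fin n → Fin n → Set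
adjMinus G F u v = (adj G u v ≡ true) × (mem F u v ≡ false)

-- F is a triangle-transversal: G \ F has no triangle
-- (adjacency is irreflexive, so u,v,w are automatically distinct).
IsTriangleTransversal : ∀ {n} (G : Graph n) → EdgeSet G → Set
IsTriangleTransversal G F =
  ∀ u v w → adjMinus G F u v → adjMinus G F v w → adjMinus G F u w → ⊥

-- F is a minimum triangle-transversal, so esize F = τ₃(G).
IsMinTriangleTransversal : ∀ {n} (G : Graph n) → EdgeSet G → Set
IsMinTriangleTransversal G F =
  IsTriangleTransversal G F × (∀ F' → IsTriangleTransversal G F' → esize F ≤ esize F')

record Orientation {n} (G : Graph n) : Set where
  field
    dir     : Fin n → Fin n → Bool
    onEdges : ∀ u v → dir u v ≡ true → adj G u v ≡ true
    exactly : ∀ u v → adj G u v ≡ true → dir u v ≢ dir v u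
open Orientation public

invert : ∀ {n} → Subset n → (Fin n → Fin n → Bool) → (Fin n → Fin n → Bool)
invert X d u v = if lookup X u ∧ lookup X v then d v u else d u v

applyInversions : ∀ {n} → List (Subset n) → (Fin n → Fin n → Bool) → (Fin n → Fin n → Bool)
applyInversions []       d = d
applyInversions (X ∷ Xs) d = applyInversions Xs (invert X d)

AllAtMost : ∀ {n} → ℕ → List (Subset n) → Set
AllAtMost p []       = Data.Unit.⊤ where import Data.Unit
AllAtMost p (X ∷ Xs) = (∣ X ∣ ≤ p) × AllAtMost p Xs

TransformableIn : ∀ {n} {G : Graph n} → ℕ → ℕ → Orientation G → Orientation G → Set
TransformableIn {n} p k O₁ O₂ =
  Σ (List (Subset n)) λ Xs → (length Xs ≤ k) × AllAtMost p Xs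
    × (∀ u v → applyInversions Xs (dir O₁) u v ≡ dir O₂ u v)

-- id^{≤p}(G) ≤ k : for all pairs of orientations the minimum number of
-- (≤p)-inversions transforming one into the other is at most k.
InvDiamLe : ∀ {n} (G : Graph n) → ℕ → ℕ → Set
InvDiamLe G p k = ∀ (O₁ O₂ : Orientation G) → TransformableIn p k O₁ O₂

{-# OPTIONS --safe #-}
module Submission where

-- Let F be a minimum triangle-transversal and H = G ∖ F. H is triangle-free, and it is
-- connected: if an edge vw of F had no common neighbour in H, then F − vw would still be
-- a triangle-transversal. A connected graph has an orientation in which at most one vertex
-- has odd out-degree (start anywhere and reverse a walk from a root to each odd vertex).
-- Pair up the out-arcs of each vertex v: for a pair vw₁, vw₂ invert {v} together with those
-- wᵢ whose arc is wrong. As w₁w₂ is not an edge of H, this repairs vw₁ and vw₂ and changes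
-- no other edge of H, so all of H is repaired with ⌈|E(H)|/2⌉ inversions. Each edge of F is
-- then repaired by one more inversion of at most its two ends, for a total of
-- ⌈|E(H)|/2⌉ + |F| = ⌈(|E(G)| + |F|)/2⌉.

open import Defs hiding (sym)

open import Data.Bool using (Bool; true; false; _∧_; not; _xor_)
open import Data.Bool.Properties
  using (T?; T-≡; T-∧; ∧-identityʳ; ∧-zeroʳ; not-¬; ¬-not; not-involutive; not-distribˡ-xor; not-distribʳ-xor;
         xor-assoc; xor-comm; xor-identityʳ; xor-same)
  renaming (_≟_ to _≟ᵇ_)
open import Data.Empty using (⊥; ⊥-elim)
open import Data.Fin using (Fin; zero; suc; toℕ; _≟_)
open import Data.Fin.Properties using (any?) renaming (suc-injective to Fin-suc-injective)
open import Data.Fin.Subset using (Subset; ⁅_⁆; _∪_; ⋃; ∣_∣; _∈_)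
open import Data.Fin.Subset.Properties using (∣p∣≤∣x∷p∣; ∣⊥∣≡0; ∣⁅x⁆∣≡1; x∈p∪q⁺; x∈p∪q⁻; x∈⁅x⁆; x∈⁅y⁆⇒x≡y; ∉⊥)
open import Data.List using (List; []; _∷_; _++_; map; allFin; tabulate; filter; length; cartesianProduct)
open import Data.List.Membership.Propositional using () renaming (_∈_ to _∈ˡ_)
open import Data.List.Membership.Propositional.Properties using (∈-filter⁺; ∈-filter⁻; ∈-allFin; ∈-cartesianProduct⁺)
open import Data.List.Properties using (map-tabulate; map-++; map-∘; length-++; length-filter)
open import Data.List.Relation.Unary.All as All using (All; []; _∷_)
open import Data.List.Relation.Unary.All.Properties using (++⁺)
open import Data.List.Relation.Unary.Any using (here; there)
open import Data.Nat using (ℕ; zero; suc; _+_; _≤_; _<_; z≤n; s≤s; _<ᵇ_; ⌈_/2⌉; ⌊_/2⌋)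
import Data.Nat.ListAction as List
open import Data.Nat.ListAction.Properties using (sum-++)
open import Data.Nat.Properties
  using (≤-refl; ≤-reflexive; ≤-trans; <⇒≱; +-identityʳ; +-suc; +-mono-≤; +-monoˡ-≤; +-monoʳ-≤; +-mono-<-≤; +-mono-≤-<;
         n≡⌊n+n/2⌋; ⌊n/2⌋-mono; +-0-commutativeMonoid; module ≤-Reasoning)
open import Data.Nat.Tactic.RingSolver using (solve-∀)
open import Data.Product using (Σ; ∃; _×_; _,_; proj₁; proj₂)
open import Data.Sum as Sum using (_⊎_; inj₁; inj₂)
open import Data.Vec using ([]; _∷_; lookup)
open import Data.Vec.Properties using ([]=⇒lookup; lookup⇒[]=)
open import Function using (_∘_; id; case_of_)
open import Function.Bundles using (Equivalence; mk⇔)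
open import Relation.Binary.PropositionalEquality
open import Relation.Nullary using (¬_; ¬?; Dec; yes; no; does; _×-dec_; _⊎-dec_)
open import Relation.Nullary.Decidable using (does-⇔; dec-true; dec-false)

open import Algebra.Properties.CommutativeMonoid.Sum +-0-commutativeMonoid
  using (sum; sum-syntax; sum-cong-≗; sum-replicate-zero; ∑-distrib-+; ∑-comm)

x∧y≡true⇒x≡true : ∀ {x y} → x ∧ y ≡ true → x ≡ true
x∧y≡true⇒x≡true {true} _ = refl

x∧y≡true⇒y≡true : ∀ {x y} → x ∧ y ≡ true → y ≡ true
x∧y≡true⇒y≡true {true} y≡true = y≡true

⟦_⟧ : Bool → ℕ
⟦ true  ⟧ = 1
⟦ false ⟧ = 0

⟦b⟧≤1 : ∀ b → ⟦ b ⟧ ≤ 1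
⟦b⟧≤1 true  = ≤-refl
⟦b⟧≤1 false = z≤n

odd : ℕ → Bool
odd zero    = false
odd (suc n) = not (odd n)

odd-⟦b⟧+n : ∀ b n → odd (⟦ b ⟧ + n) ≡ b xor odd n
odd-⟦b⟧+n true  n = refl
odd-⟦b⟧+n false n = refl

⌈n/2⌉+⌈n/2⌉≡n+⟦odd-n⟧ : ∀ n → ⌈ n /2⌉ + ⌈ n /2⌉ ≡ n + ⟦ odd n ⟧
⌈n/2⌉+⌈n/2⌉≡n+⟦odd-n⟧ zero          = refl
⌈n/2⌉+⌈n/2⌉≡n+⟦odd-n⟧ (suc zero)    = refl
⌈n/2⌉+⌈n/2⌉≡n+⟦odd-n⟧ (suc (suc n)) = begin
  suc (⌈ n /2⌉ + suc ⌈ n /2⌉)            ≡⟨ cong suc (+-suc ⌈ n /2⌉ ⌈ n /2⌉) ⟩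
  2 + (⌈ n /2⌉ + ⌈ n /2⌉)                ≡⟨ cong (2 +_) (⌈n/2⌉+⌈n/2⌉≡n+⟦odd-n⟧ n) ⟩
  2 + (n + ⟦ odd n ⟧)                    ≡⟨ cong (λ b → 2 + (n + ⟦ b ⟧)) (not-involutive (odd n)) ⟨
  2 + (n + ⟦ not (not (odd n)) ⟧)        ∎
  where open ≡-Reasoning

xor-telescope : ∀ o r a b → (o xor (r xor a)) xor (a xor b) ≡ o xor (r xor b)
xor-telescope o r a b = begin
  (o xor (r xor a)) xor (a xor b)   ≡⟨ xor-assoc o (r xor a) (a xor b) ⟩
  o xor ((r xor a) xor (a xor b))   ≡⟨ cong (o xor_) (xor-assoc r a (a xor b)) ⟩
  o xor (r xor (a xor (a xor b)))   ≡⟨ cong (λ t → o xor (r xor t)) (xor-assoc a a b) ⟨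
  o xor (r xor ((a xor a) xor b))   ≡⟨ cong (λ t → o xor (r xor (t xor b))) (xor-same a) ⟩
  o xor (r xor b)                   ∎
  where open ≡-Reasoning

∑-mono-≤ : ∀ {n} {f g : Fin n → ℕ} → (∀ i → f i ≤ g i) → sum f ≤ sum g
∑-mono-≤ {zero}  f≤g = z≤n
∑-mono-≤ {suc n} f≤g = +-mono-≤ (f≤g zero) (∑-mono-≤ (f≤g ∘ suc))

∑-mono-< : ∀ {n} {f g : Fin n → ℕ} → (∀ i → f i ≤ g i) → ∀ k → f k < g k → sum f < sum g
∑-mono-< f≤g zero    fk<gk = +-mono-<-≤ fk<gk (∑-mono-≤ (f≤g ∘ suc))
∑-mono-< f≤g (suc k) fk<gk = +-mono-≤-< (f≤g zero) (∑-mono-< (f≤g ∘ suc) k fk<gk)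

∑-single : ∀ {n} {f : Fin n → ℕ} i → (∀ j → j ≢ i → f j ≡ 0) → sum f ≡ f i
∑-single {suc n} {f} zero others = begin
  f zero + sum (f ∘ suc)      ≡⟨ cong (f zero +_) (sum-cong-≗ (λ j → others (suc j) λ ())) ⟩
  f zero + sum {n} (λ _ → 0)  ≡⟨ cong (f zero +_) (sum-replicate-zero n) ⟩
  f zero + 0                  ≡⟨ +-identityʳ (f zero) ⟩
  f zero                      ∎
  where open ≡-Reasoning
∑-single {suc n} (suc i) others =
  cong₂ _+_ (others zero λ ()) (∑-single i (λ j j≢i → others (suc j) (j≢i ∘ Fin-suc-injective)))

odd-∑-flip : ∀ {n} {f g : Fin n → Bool} i → (∀ j → j ≢ i → f j ≡ g j) → g i ≡ not (f i) →
             odd (sum (⟦_⟧ ∘ g)) ≡ not (odd (sum (⟦_⟧ ∘ f)))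
odd-∑-flip {suc n} {f} {g} zero same flip = begin
  odd (⟦ g zero ⟧ + sum (⟦_⟧ ∘ g ∘ suc))         ≡⟨ odd-⟦b⟧+n (g zero) _ ⟩
  g zero xor odd (sum (⟦_⟧ ∘ g ∘ suc))           ≡⟨ cong₂ (λ b s → b xor odd s) flip
                                                           (sum-cong-≗ (λ j → cong ⟦_⟧ (sym (same (suc j) λ ())))) ⟩
  not (f zero) xor odd (sum (⟦_⟧ ∘ f ∘ suc))     ≡⟨ not-distribˡ-xor (f zero) _ ⟨
  not (f zero xor odd (sum (⟦_⟧ ∘ f ∘ suc)))     ≡⟨ cong not (odd-⟦b⟧+n (f zero) _) ⟨
  not (odd (⟦ f zero ⟧ + sum (⟦_⟧ ∘ f ∘ suc)))   ∎
  where open ≡-Reasoning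
odd-∑-flip {suc n} {f} {g} (suc i) same flip = begin
  odd (⟦ g zero ⟧ + sum (⟦_⟧ ∘ g ∘ suc))         ≡⟨ odd-⟦b⟧+n (g zero) _ ⟩
  g zero xor odd (sum (⟦_⟧ ∘ g ∘ suc))           ≡⟨ cong₂ _xor_ (sym (same zero λ ()))
                                                      (odd-∑-flip i (λ j j≢i → same (suc j) (j≢i ∘ Fin-suc-injective)) flip) ⟩
  f zero xor not (odd (sum (⟦_⟧ ∘ f ∘ suc)))     ≡⟨ not-distribʳ-xor (f zero) _ ⟨
  not (f zero xor odd (sum (⟦_⟧ ∘ f ∘ suc)))     ≡⟨ cong not (odd-⟦b⟧+n (f zero) _) ⟨
  not (odd (⟦ f zero ⟧ + sum (⟦_⟧ ∘ f ∘ suc)))   ∎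
  where open ≡-Reasoning

sum-tabulate : ∀ {n} (f : Fin n → ℕ) → List.sum (tabulate f) ≡ sum f
sum-tabulate {zero}  f = refl
sum-tabulate {suc n} f = cong (f zero +_) (sum-tabulate (f ∘ suc))

sum-map-allFin : ∀ {n} (f : Fin n → ℕ) → List.sum (map f (allFin n)) ≡ sum f
sum-map-allFin f = trans (cong List.sum (map-tabulate id f)) (sum-tabulate f)

length-filter-T? : ∀ {A : Set} (p : A → Bool) xs → length (filter (T? ∘ p) xs) ≡ List.sum (map (⟦_⟧ ∘ p) xs)
length-filter-T? p []       = refl
length-filter-T? p (x ∷ xs) with p x
... | true  = cong suc (length-filter-T? p xs)
... | false = length-filter-T? p xs

sum-map-cartesianProduct : ∀ {A B : Set} (g : A × B → ℕ) xs ys →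
  List.sum (map g (cartesianProduct xs ys)) ≡ List.sum (map (λ x → List.sum (map (λ y → g (x , y)) ys)) xs)
sum-map-cartesianProduct g []       ys = refl
sum-map-cartesianProduct g (x ∷ xs) ys = begin
  List.sum (map g (map (x ,_) ys ++ cartesianProduct xs ys))
    ≡⟨ cong List.sum (map-++ g (map (x ,_) ys) _) ⟩
  List.sum (map g (map (x ,_) ys) ++ map g (cartesianProduct xs ys))
    ≡⟨ sum-++ (map g (map (x ,_) ys)) _ ⟩
  List.sum (map g (map (x ,_) ys)) + List.sum (map g (cartesianProduct xs ys))
    ≡⟨ cong₂ _+_ (cong List.sum (sym (map-∘ ys))) (sum-map-cartesianProduct g xs ys) ⟩
  List.sum (map (λ y → g (x , y)) ys) + List.sum (map (λ x → List.sum (map (λ y → g (x , y)) ys)) xs) ∎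
  where open ≡-Reasoning

_<ᶠ_ : ∀ {n} → Fin n → Fin n → Bool
u <ᶠ v = toℕ u <ᵇ toℕ v

<ᶠ-flip : ∀ {n} {u v : Fin n} → u ≢ v → v <ᶠ u ≡ not (u <ᶠ v)
<ᶠ-flip {u = zero}  {zero}  u≢v = ⊥-elim (u≢v refl)
<ᶠ-flip {u = zero}  {suc v} u≢v = refl
<ᶠ-flip {u = suc u} {zero}  u≢v = refl
<ᶠ-flip {u = suc u} {suc v} u≢v = <ᶠ-flip (u≢v ∘ cong suc)

countPairs≡∑∑ : ∀ {n} (f : Fin n → Fin n → Bool) → countPairs f ≡ ∑[ u < n ] ∑[ v < n ] ⟦ u <ᶠ v ∧ f u v ⟧
countPairs≡∑∑ {n} f = begin
  countPairs f
    ≡⟨ length-filter-T? (λ (u , v) → u <ᶠ v ∧ f u v) (cartesianProduct (allFin n) (allFin n)) ⟩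
  List.sum (map (λ (u , v) → ⟦ u <ᶠ v ∧ f u v ⟧) (cartesianProduct (allFin n) (allFin n)))
    ≡⟨ sum-map-cartesianProduct _ (allFin n) (allFin n) ⟩
  List.sum (map (λ u → List.sum (map (λ v → ⟦ u <ᶠ v ∧ f u v ⟧) (allFin n))) (allFin n))
    ≡⟨ sum-map-allFin {n} _ ⟩
  ∑[ u < n ] List.sum (map (λ v → ⟦ u <ᶠ v ∧ f u v ⟧) (allFin n))
    ≡⟨ sum-cong-≗ {n} (λ u → sum-map-allFin (λ v → ⟦ u <ᶠ v ∧ f u v ⟧)) ⟩
  ∑[ u < n ] ∑[ v < n ] ⟦ u <ᶠ v ∧ f u v ⟧ ∎
  where open ≡-Reasoning

countPairs-split : ∀ {n} (f g : Fin n → Fin n → Bool) → (∀ a b → f a b ≡ true → g a b ≡ true) →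
                   countPairs g ≡ countPairs (λ a b → g a b ∧ not (f a b)) + countPairs f
countPairs-split {n} f g f⇒g = begin
  countPairs g
    ≡⟨ countPairs≡∑∑ g ⟩
  ∑[ u < n ] ∑[ v < n ] ⟦ u <ᶠ v ∧ g u v ⟧
    ≡⟨ sum-cong-≗ {n} (λ u → sum-cong-≗ {n} (pointwise u)) ⟩
  ∑[ u < n ] ∑[ v < n ] (⟦ u <ᶠ v ∧ (g u v ∧ not (f u v)) ⟧ + ⟦ u <ᶠ v ∧ f u v ⟧)
    ≡⟨ sum-cong-≗ {n} (λ u → ∑-distrib-+ (λ v → ⟦ u <ᶠ v ∧ (g u v ∧ not (f u v)) ⟧) _) ⟩
  ∑[ u < n ] (∑[ v < n ] ⟦ u <ᶠ v ∧ (g u v ∧ not (f u v)) ⟧ + ∑[ v < n ] ⟦ u <ᶠ v ∧ f u v ⟧)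
    ≡⟨ ∑-distrib-+ (λ u → ∑[ v < n ] ⟦ u <ᶠ v ∧ (g u v ∧ not (f u v)) ⟧) _ ⟩
  ∑[ u < n ] ∑[ v < n ] ⟦ u <ᶠ v ∧ (g u v ∧ not (f u v)) ⟧ + ∑[ u < n ] ∑[ v < n ] ⟦ u <ᶠ v ∧ f u v ⟧
    ≡⟨ cong₂ _+_ (countPairs≡∑∑ (λ a b → g a b ∧ not (f a b))) (countPairs≡∑∑ f) ⟨
  countPairs (λ a b → g a b ∧ not (f a b)) + countPairs f
    ∎
  where
  open ≡-Reasoning
  pointwise : ∀ u v → ⟦ u <ᶠ v ∧ g u v ⟧ ≡ ⟦ u <ᶠ v ∧ (g u v ∧ not (f u v)) ⟧ + ⟦ u <ᶠ v ∧ f u v ⟧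
  pointwise u v with u <ᶠ v | f u v in fuv | g u v in guv
  ... | false | _     | _     = refl
  ... | true  | false | false = refl
  ... | true  | false | true  = refl
  ... | true  | true  | true  = refl
  ... | true  | true  | false = case trans (sym (f⇒g u v fuv)) guv of λ ()

countPairs-<-ordered : ∀ {n} (f g : Fin n → Fin n → Bool) → (∀ a b → f a b ≡ true → g a b ≡ true) →
                       ∀ {a b} → a <ᶠ b ≡ true → g a b ≡ true → f a b ≡ false → countPairs f < countPairs g
countPairs-<-ordered {n} f g f⇒g {a} {b} a<b gab ¬fab = begin-strict
  countPairs f                              ≡⟨ countPairs≡∑∑ f ⟩
  ∑[ u < n ] ∑[ v < n ] ⟦ u <ᶠ v ∧ f u v ⟧  <⟨ ∑-mono-< (∑-mono-≤ ∘ pointwise) a (∑-mono-< (pointwise a) b strictAt) ⟩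
  ∑[ u < n ] ∑[ v < n ] ⟦ u <ᶠ v ∧ g u v ⟧  ≡⟨ countPairs≡∑∑ g ⟨
  countPairs g                              ∎
  where
  open ≤-Reasoning
  pointwise : ∀ u v → ⟦ u <ᶠ v ∧ f u v ⟧ ≤ ⟦ u <ᶠ v ∧ g u v ⟧
  pointwise u v with u <ᶠ v | f u v in fuv
  ... | false | _     = z≤n
  ... | true  | false = z≤n
  ... | true  | true  rewrite f⇒g u v fuv = ≤-refl
  strictAt : ⟦ a <ᶠ b ∧ f a b ⟧ < ⟦ a <ᶠ b ∧ g a b ⟧
  strictAt rewrite a<b | gab | ¬fab = s≤s z≤n

countPairs-< : ∀ {n} (f g : Fin n → Fin n → Bool) → (∀ a b → f a b ≡ true → g a b ≡ true) →
               (∀ a b → f a b ≡ f b a) → (∀ a b → g a b ≡ g b a) →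
               ∀ {a b} → a ≢ b → g a b ≡ true → f a b ≡ false → countPairs f < countPairs g
countPairs-< f g f⇒g f-sym g-sym {a} {b} a≢b gab ¬fab with a <ᶠ b in a<b
... | true  = countPairs-<-ordered f g f⇒g a<b gab ¬fab
... | false = countPairs-<-ordered f g f⇒g (trans (<ᶠ-flip a≢b) (cong not a<b))
                                         (trans (g-sym b a) gab) (trans (f-sym b a) ¬fab)

adj⇒≢ : ∀ {n} (K : Graph n) {u v} → adj K u v ≡ true → u ≢ v
adj⇒≢ K {u} uv refl = case trans (sym uv) (irrefl K u) of λ ()

_⊆ᴳ_ : ∀ {n} → Graph n → Graph n → Set
K ⊆ᴳ G = ∀ {u v} → adj K u v ≡ true → adj G u v ≡ true

TriangleFree : ∀ {n} → Graph n → Set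
TriangleFree K = ∀ u v w → adj K u v ≡ true → adj K v w ≡ true → adj K u w ≡ true → ⊥

neighbours-nonadjacent : ∀ {n} {K : Graph n} → TriangleFree K → ∀ {v ws} → All (λ w → adj K v w ≡ true) ws →
                         ∀ {a b} → a ∈ˡ ws → b ∈ˡ ws → ¬ adj K a b ≡ true
neighbours-nonadjacent △-free {v} v~ws a∈ws b∈ws ab = △-free v _ _ (All.lookup v~ws a∈ws) ab (All.lookup v~ws b∈ws)

SameEdge : ∀ {n} → Fin n → Fin n → Fin n → Fin n → Set
SameEdge v w a b = (a ≡ v × b ≡ w) ⊎ (a ≡ w × b ≡ v)

sameEdge? : ∀ {n} (v w a b : Fin n) → Dec (SameEdge v w a b)
sameEdge? v w a b = (a ≟ v ×-dec b ≟ w) ⊎-dec (a ≟ w ×-dec b ≟ v)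

SameEdge-swap : ∀ {n} {v w a b : Fin n} → SameEdge v w a b → SameEdge v w b a
SameEdge-swap (inj₁ (a≡v , b≡w)) = inj₂ (b≡w , a≡v)
SameEdge-swap (inj₂ (a≡w , b≡v)) = inj₁ (b≡v , a≡w)

SameEdge-functional : ∀ {n} {v w a b c : Fin n} → SameEdge v w a b → SameEdge v w a c → b ≡ c
SameEdge-functional (inj₁ (refl , refl)) (inj₁ (_    , refl)) = refl
SameEdge-functional (inj₁ (refl , refl)) (inj₂ (refl , refl)) = refl
SameEdge-functional (inj₂ (refl , refl)) (inj₁ (refl , refl)) = refl
SameEdge-functional (inj₂ (refl , refl)) (inj₂ (_    , refl)) = refl

_∖_ : ∀ {n} (G : Graph n) → EdgeSet G → Graph n
G ∖ F = record
  { adj    = λ u v → adj G u v ∧ not (mem F u v)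
  ; sym    = λ u v → cong₂ (λ a f → a ∧ not f) (Graph.sym G u v) (EdgeSet.sym F u v)
  ; irrefl = λ u → cong (_∧ not (mem F u u)) (irrefl G u)
  }

module _ {n} {G : Graph n} (F : EdgeSet G) where

  ∖-adj⁺ : ∀ {u v} → adjMinus G F u v → adj (G ∖ F) u v ≡ true
  ∖-adj⁺ (uv , ¬Fuv) rewrite uv | ¬Fuv = refl

  ∖-adj⁻ : ∀ {u v} → adj (G ∖ F) u v ≡ true → adjMinus G F u v
  ∖-adj⁻ {u} {v} uv with adj G u v | mem F u v
  ... | true | false = refl , refl

  adjMinus-sym : ∀ {a b} → adjMinus G F a b → adjMinus G F b a
  adjMinus-sym {a} {b} (ab , Fab) = trans (Graph.sym G b a) ab , trans (EdgeSet.sym F b a) Fab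

  ∖⊆ : (G ∖ F) ⊆ᴳ G
  ∖⊆ = proj₁ ∘ ∖-adj⁻

  transversal⇒triangleFree : IsTriangleTransversal G F → TriangleFree (G ∖ F)
  transversal⇒triangleFree trF u v w uv vw uw = trF u v w (∖-adj⁻ uv) (∖-adj⁻ vw) (∖-adj⁻ uw)

  numEdges-∖ : numEdges G ≡ numEdges (G ∖ F) + esize F
  numEdges-∖ = countPairs-split (mem F) (adj G) (sub F)

module _ {n} {K : Graph n} where

  outdeg : Orientation K → Fin n → ℕ
  outdeg O v = ∑[ w < n ] ⟦ dir O v w ⟧

  dir-nonEdge : (O : Orientation K) → ∀ {u v} → adj K u v ≡ false → dir O u v ≡ false
  dir-nonEdge O {u} {v} ¬uv with dir O u v in uv
  ... | true  = case trans (sym (onEdges O u v uv)) ¬uv of λ ()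
  ... | false = refl

  dir-flip : (O : Orientation K) → ∀ {u v} → adj K u v ≡ true → dir O v u ≡ not (dir O u v)
  dir-flip O {u} {v} uv = ¬-not (exactly O u v uv ∘ sym)

  dir+dir≡adj : (O : Orientation K) → ∀ u v → ⟦ dir O u v ⟧ + ⟦ dir O v u ⟧ ≡ ⟦ adj K u v ⟧
  dir+dir≡adj O u v with adj K u v in uv
  ... | false rewrite dir-nonEdge O uv | dir-nonEdge O (trans (Graph.sym K v u) uv) = refl
  ... | true  rewrite dir-flip O uv with dir O u v
  ...   | true  = refl
  ...   | false = refl

  ∑outdeg+∑outdeg : (O : Orientation K) → sum (outdeg O) + sum (outdeg O) ≡ ∑[ u < n ] ∑[ v < n ] ⟦ adj K u v ⟧
  ∑outdeg+∑outdeg O = begin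
    sum (outdeg O) + sum (outdeg O)
      ≡⟨ cong (sum (outdeg O) +_) (∑-comm (λ v u → ⟦ dir O v u ⟧)) ⟩
    sum (outdeg O) + ∑[ u < n ] ∑[ v < n ] ⟦ dir O v u ⟧
      ≡⟨ ∑-distrib-+ (outdeg O) _ ⟨
    ∑[ u < n ] (outdeg O u + ∑[ v < n ] ⟦ dir O v u ⟧)
      ≡⟨ sum-cong-≗ (λ u → ∑-distrib-+ (λ v → ⟦ dir O u v ⟧) _) ⟨
    ∑[ u < n ] ∑[ v < n ] (⟦ dir O u v ⟧ + ⟦ dir O v u ⟧)
      ≡⟨ sum-cong-≗ (λ u → sum-cong-≗ (dir+dir≡adj O u)) ⟩
    ∑[ u < n ] ∑[ v < n ] ⟦ adj K u v ⟧
      ∎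
    where open ≡-Reasoning

  -- Its out-degrees add up to numEdges K by the very definition of countPairs.
  byIndex : Orientation K
  byIndex = record
    { dir     = λ u v → u <ᶠ v ∧ adj K u v
    ; onEdges = λ u v → x∧y≡true⇒y≡true
    ; exactly = exactly′
    }
    where
    exactly′ : ∀ u v → adj K u v ≡ true → u <ᶠ v ∧ adj K u v ≢ v <ᶠ u ∧ adj K v u
    exactly′ u v uv rewrite uv | Graph.sym K v u | uv | <ᶠ-flip (adj⇒≢ K uv)
                          | ∧-identityʳ (u <ᶠ v) | ∧-identityʳ (not (u <ᶠ v)) = not-¬ refl

  numEdges≡∑outdeg : (O : Orientation K) → numEdges K ≡ sum (outdeg O)
  numEdges≡∑outdeg O = begin
    numEdges K                                         ≡⟨ countPairs≡∑∑ (adj K) ⟩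
    sum (outdeg byIndex)                               ≡⟨ n≡⌊n+n/2⌋ _ ⟩
    ⌊ sum (outdeg byIndex) + sum (outdeg byIndex) /2⌋
      ≡⟨ cong ⌊_/2⌋ (trans (∑outdeg+∑outdeg byIndex) (sym (∑outdeg+∑outdeg O))) ⟩
    ⌊ sum (outdeg O) + sum (outdeg O) /2⌋              ≡⟨ n≡⌊n+n/2⌋ _ ⟨
    sum (outdeg O)                                     ∎
    where open ≡-Reasoning

-- Inversions

∣p∪q∣≤∣p∣+∣q∣ : ∀ {n} (p q : Subset n) → ∣ p ∪ q ∣ ≤ ∣ p ∣ + ∣ q ∣
∣p∪q∣≤∣p∣+∣q∣ []          []          = z≤n
∣p∪q∣≤∣p∣+∣q∣ (true  ∷ p) (t ∷ q)     = s≤s (≤-trans (∣p∪q∣≤∣p∣+∣q∣ p q) (+-monoʳ-≤ ∣ p ∣ (∣p∣≤∣x∷p∣ t q)))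
∣p∪q∣≤∣p∣+∣q∣ (false ∷ p) (true  ∷ q) = ≤-trans (s≤s (∣p∪q∣≤∣p∣+∣q∣ p q)) (≤-reflexive (sym (+-suc ∣ p ∣ ∣ q ∣)))
∣p∪q∣≤∣p∣+∣q∣ (false ∷ p) (false ∷ q) = ∣p∪q∣≤∣p∣+∣q∣ p q

fromList : ∀ {n} → List (Fin n) → Subset n
fromList xs = ⋃ (map ⁅_⁆ xs)

∣fromList∣≤length : ∀ {n} (xs : List (Fin n)) → ∣ fromList xs ∣ ≤ length xs
∣fromList∣≤length {n} []   = ≤-reflexive (∣⊥∣≡0 n)
∣fromList∣≤length (x ∷ xs) = begin
  ∣ ⁅ x ⁆ ∪ fromList xs ∣      ≤⟨ ∣p∪q∣≤∣p∣+∣q∣ ⁅ x ⁆ (fromList xs) ⟩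
  ∣ ⁅ x ⁆ ∣ + ∣ fromList xs ∣  ≤⟨ +-mono-≤ (≤-reflexive (∣⁅x⁆∣≡1 x)) (∣fromList∣≤length xs) ⟩
  suc (length xs)              ∎
  where open ≤-Reasoning

∈-fromList⁺ : ∀ {n} {a : Fin n} xs → a ∈ˡ xs → a ∈ fromList xs
∈-fromList⁺ {a = a} (x ∷ xs) (here refl)  = x∈p∪q⁺ (inj₁ (x∈⁅x⁆ a))
∈-fromList⁺         (x ∷ xs) (there a∈xs) = x∈p∪q⁺ (inj₂ (∈-fromList⁺ xs a∈xs))

∈-fromList⁻ : ∀ {n} {a : Fin n} xs → a ∈ fromList xs → a ∈ˡ xs
∈-fromList⁻ []       a∈ = ⊥-elim (∉⊥ a∈)
∈-fromList⁻ (x ∷ xs) a∈ with x∈p∪q⁻ ⁅ x ⁆ (fromList xs) a∈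
... | inj₁ a∈⁅x⁆ = here (x∈⁅y⁆⇒x≡y x a∈⁅x⁆)
... | inj₂ a∈xs  = there (∈-fromList⁻ xs a∈xs)

invert-inside : ∀ {n} {X : Subset n} {u v} → u ∈ X → v ∈ X → ∀ d → invert X d u v ≡ d v u
invert-inside u∈X v∈X d rewrite []=⇒lookup u∈X | []=⇒lookup v∈X = refl

invert-outside : ∀ {n} {X : Subset n} {u v} → ¬ (u ∈ X × v ∈ X) → ∀ d → invert X d u v ≡ d u v
invert-outside {X = X} {u} {v} ¬both d with lookup X u in u∈X | lookup X v in v∈X
... | true  | true  = ⊥-elim (¬both (lookup⇒[]= u X u∈X , lookup⇒[]= v X v∈X))
... | true  | false = refl
... | false | _     = refl

invert-diagonal : ∀ {n} (X : Subset n) d u → invert X d u u ≡ d u u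
invert-diagonal X d u with lookup X u ∧ lookup X u
... | true  = refl
... | false = refl

invert-cong : ∀ {n} (X : Subset n) {d d′ : Fin n → Fin n → Bool} → (∀ u v → d u v ≡ d′ u v) →
              ∀ u v → invert X d u v ≡ invert X d′ u v
invert-cong X d≗d′ u v with lookup X u ∧ lookup X v
... | true  = d≗d′ v u
... | false = d≗d′ u v

invertO : ∀ {n} {K : Graph n} → Subset n → Orientation K → Orientation K
invertO {K = K} X O = record
  { dir     = invert X (dir O)
  ; onEdges = onEdges′
  ; exactly = exactly′
  }
  where
  onEdges′ : ∀ u v → invert X (dir O) u v ≡ true → adj K u v ≡ true
  onEdges′ u v with lookup X u ∧ lookup X v
  ... | true  = λ vu → trans (Graph.sym K u v) (onEdges O v u vu)
  ... | false = onEdges O u v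
  exactly′ : ∀ u v → adj K u v ≡ true → invert X (dir O) u v ≢ invert X (dir O) v u
  exactly′ u v uv with lookup X u | lookup X v
  ... | true  | true  = exactly O u v uv ∘ sym
  ... | true  | false = exactly O u v uv
  ... | false | true  = exactly O u v uv
  ... | false | false = exactly O u v uv

applyInversions-++ : ∀ {n} (Xs Ys : List (Subset n)) d →
                     applyInversions (Xs ++ Ys) d ≡ applyInversions Ys (applyInversions Xs d)
applyInversions-++ []       Ys d = refl
applyInversions-++ (X ∷ Xs) Ys d = applyInversions-++ Xs Ys (invert X d)

applyInversions-cong : ∀ {n} (Xs : List (Subset n)) {d d′ : Fin n → Fin n → Bool} → (∀ u v → d u v ≡ d′ u v) →
                       ∀ u v → applyInversions Xs d u v ≡ applyInversions Xs d′ u v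
applyInversions-cong []       d≗d′ = d≗d′
applyInversions-cong (X ∷ Xs) d≗d′ = applyInversions-cong Xs (invert-cong X d≗d′)

AllAtMost-++ : ∀ {n p} (Xs : List (Subset n)) {Ys} → AllAtMost p Xs → AllAtMost p Ys → AllAtMost p (Xs ++ Ys)
AllAtMost-++ []       _            Ys≤p = Ys≤p
AllAtMost-++ (X ∷ Xs) (X≤p , Xs≤p) Ys≤p = X≤p , AllAtMost-++ Xs Xs≤p Ys≤p

module _ {n} {G : Graph n} {p : ℕ} where

  TransformableIn-refl : {O : Orientation G} → TransformableIn p 0 O O
  TransformableIn-refl = [] , z≤n , _ , λ u v → refl

  TransformableIn-invert : ∀ {X} → ∣ X ∣ ≤ p → (O : Orientation G) → TransformableIn p 1 O (invertO X O)
  TransformableIn-invert {X} X≤p O = X ∷ [] , ≤-refl , (X≤p , _) , λ u v → refl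

  TransformableIn-trans : ∀ {k l} {O O′ O″ : Orientation G} →
                          TransformableIn p k O O′ → TransformableIn p l O′ O″ → TransformableIn p (k + l) O O″
  TransformableIn-trans {O = O} (Xs , |Xs| , Xs≤p , O↦O′) (Ys , |Ys| , Ys≤p , O′↦O″) =
      Xs ++ Ys
    , ≤-trans (≤-reflexive (length-++ Xs)) (+-mono-≤ |Xs| |Ys|)
    , AllAtMost-++ Xs Xs≤p Ys≤p
    , λ u v → trans (cong (λ d → d u v) (applyInversions-++ Xs Ys (dir O)))
                    (trans (applyInversions-cong Ys O↦O′ u v) (O′↦O″ u v))

  TransformableIn-weaken : ∀ {k l} {O O′ : Orientation G} → k ≤ l → TransformableIn p k O O′ → TransformableIn p l O O′
  TransformableIn-weaken k≤l (Xs , |Xs| , Xs≤p , O↦O′) = Xs , ≤-trans |Xs| k≤l , Xs≤p , O↦O′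

  TransformableIn-target : ∀ {k} {O O′ O″ : Orientation G} → (∀ u v → dir O′ u v ≡ dir O″ u v) →
                           TransformableIn p k O O′ → TransformableIn p k O O″
  TransformableIn-target O′≗O″ (Xs , |Xs| , Xs≤p , O↦O′) = Xs , |Xs| , Xs≤p , λ u v → trans (O↦O′ u v) (O′≗O″ u v)

-- Orientations with at most one odd out-degree

module _ {n} {K : Graph n} where

  reverseArc : Fin n → Fin n → Orientation K → Orientation K
  reverseArc x y = invertO (fromList (x ∷ y ∷ []))

  module _ (O : Orientation K) {x y : Fin n} (xy : adj K x y ≡ true) where

    reverseArc-changed : ∀ {a b} → SameEdge x y a b → dir (reverseArc x y O) a b ≡ not (dir O a b)
    reverseArc-changed {a} {b} ab = trans (invert-inside (end ab) (end (SameEdge-swap ab)) (dir O)) (dir-flip O (edge ab))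
      where
      end : ∀ {a b} → SameEdge x y a b → a ∈ fromList (x ∷ y ∷ [])
      end (inj₁ (refl , _)) = ∈-fromList⁺ (x ∷ y ∷ []) (here refl)
      end (inj₂ (refl , _)) = ∈-fromList⁺ (x ∷ y ∷ []) (there (here refl))
      edge : SameEdge x y a b → adj K a b ≡ true
      edge (inj₁ (refl , refl)) = xy
      edge (inj₂ (refl , refl)) = trans (Graph.sym K y x) xy

    reverseArc-unchanged : ∀ {a b} → ¬ SameEdge x y a b → dir (reverseArc x y O) a b ≡ dir O a b
    reverseArc-unchanged {a} {b} ¬ab with a ≟ b
    ... | yes refl = invert-diagonal (fromList (x ∷ y ∷ [])) (dir O) a
    ... | no  a≢b  =
      invert-outside (λ (a∈ , b∈) → ¬ab (ends (∈-fromList⁻ (x ∷ y ∷ []) a∈) (∈-fromList⁻ (x ∷ y ∷ []) b∈))) (dir O)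
      where
      ends : a ∈ˡ x ∷ y ∷ [] → b ∈ˡ x ∷ y ∷ [] → SameEdge x y a b
      ends (here a≡x)         (here b≡x)         = ⊥-elim (a≢b (trans a≡x (sym b≡x)))
      ends (here a≡x)         (there (here b≡y)) = inj₁ (a≡x , b≡y)
      ends (there (here a≡y)) (here b≡x)         = inj₂ (a≡y , b≡x)
      ends (there (here a≡y)) (there (here b≡y)) = ⊥-elim (a≢b (trans a≡y (sym b≡y)))

    odd-outdeg-reverseArc-end : ∀ {z i} → SameEdge x y z i → odd (outdeg (reverseArc x y O) z) ≡ not (odd (outdeg O z))
    odd-outdeg-reverseArc-end zi =
      odd-∑-flip _ (λ j j≢i → sym (reverseArc-unchanged (λ zj → j≢i (SameEdge-functional zj zi)))) (reverseArc-changed zi)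

    outdeg-reverseArc-other : ∀ {z} → z ≢ x → z ≢ y → outdeg (reverseArc x y O) z ≡ outdeg O z
    outdeg-reverseArc-other z≢x z≢y =
      sum-cong-≗ {n} λ j → cong ⟦_⟧ (reverseArc-unchanged {b = j} λ { (inj₁ (z≡x , _)) → z≢x z≡x
                                                                    ; (inj₂ (z≡y , _)) → z≢y z≡y })

    odd-outdeg-reverseArc : ∀ z → odd (outdeg (reverseArc x y O) z) ≡ odd (outdeg O z) xor (does (z ≟ x) xor does (z ≟ y))
    odd-outdeg-reverseArc z with z ≟ x | z ≟ y
    ... | yes refl | yes refl = ⊥-elim (adj⇒≢ K xy refl)
    ... | yes refl | no  _    = trans (odd-outdeg-reverseArc-end (inj₁ (refl , refl))) (xor-comm true _)
    ... | no  _    | yes refl = trans (odd-outdeg-reverseArc-end (inj₂ (refl , refl))) (xor-comm true _)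
    ... | no  z≢x  | no  z≢y  = trans (cong odd (outdeg-reverseArc-other z≢x z≢y)) (sym (xor-identityʳ _))

  reverseWalk : ∀ {r v} → Reach K r v → Orientation K → Orientation K
  reverseWalk here                  O = O
  reverseWalk (step {a} {b} walk _) O = reverseArc a b (reverseWalk walk O)

  odd-outdeg-reverseWalk : ∀ {r v} (walk : Reach K r v) O z →
                           odd (outdeg (reverseWalk walk O) z) ≡ odd (outdeg O z) xor (does (z ≟ r) xor does (z ≟ v))
  odd-outdeg-reverseWalk {r} here O z =
    sym (trans (cong (odd (outdeg O z) xor_) (xor-same (does (z ≟ r)))) (xor-identityʳ _))
  odd-outdeg-reverseWalk {r} (step {a} {b} walk ab) O z = begin
    odd (outdeg (reverseArc a b (reverseWalk walk O)) z)
      ≡⟨ odd-outdeg-reverseArc (reverseWalk walk O) ab z ⟩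
    odd (outdeg (reverseWalk walk O) z) xor (does (z ≟ a) xor does (z ≟ b))
      ≡⟨ cong (_xor (does (z ≟ a) xor does (z ≟ b))) (odd-outdeg-reverseWalk walk O z) ⟩
    (odd (outdeg O z) xor (does (z ≟ r) xor does (z ≟ a))) xor (does (z ≟ a) xor does (z ≟ b))
      ≡⟨ xor-telescope (odd (outdeg O z)) (does (z ≟ r)) (does (z ≟ a)) (does (z ≟ b)) ⟩
    odd (outdeg O z) xor (does (z ≟ r) xor does (z ≟ b))
      ∎
    where open ≡-Reasoning

  EvenAwayFrom : Fin n → Orientation K → Fin n → Set
  EvenAwayFrom r O v = v ≢ r → odd (outdeg O v) ≡ false

  evenAwayFrom-all : ∀ r → (∀ v → Reach K r v) → ∀ vs → Σ (Orientation K) λ O → All (EvenAwayFrom r O) vs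
  evenAwayFrom-all r reach []       = byIndex , []
  evenAwayFrom-all r reach (v ∷ vs) with evenAwayFrom-all r reach vs
  ... | O , evens with odd (outdeg O v) in odd-v
  ...   | false = O , (λ _ → odd-v) ∷ evens
  ...   | true  = O′ , repaired (λ v≢v → ⊥-elim (v≢v refl)) ∷ All.map (λ even → repaired (λ _ → even)) evens
    where
    O′ : Orientation K
    O′ = reverseWalk (reach v) O
    repaired : ∀ {u} → (u ≢ v → EvenAwayFrom r O u) → EvenAwayFrom r O′ u
    repaired {u} even u≢r = begin
      odd (outdeg O′ u)                                      ≡⟨ odd-outdeg-reverseWalk (reach v) O u ⟩
      odd (outdeg O u) xor (does (u ≟ r) xor does (u ≟ v))   ≡⟨ cong (λ t → odd (outdeg O u) xor (t xor does (u ≟ v)))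
                                                                     (dec-false (u ≟ r) u≢r) ⟩
      odd (outdeg O u) xor does (u ≟ v)                      ≡⟨ cancel (u ≟ v) ⟩
      false                                                  ∎
      where
      open ≡-Reasoning
      cancel : (u≟v : Dec (u ≡ v)) → odd (outdeg O u) xor does u≟v ≡ false
      cancel (yes refl) = cong (_xor true) odd-v
      cancel (no u≢v)   = trans (xor-identityʳ _) (even u≢v u≢r)

  oddVertices : Orientation K → ℕ
  oddVertices O = ∑[ v < n ] ⟦ odd (outdeg O v) ⟧

  ∑⌈outdeg/2⌉-bound : (O : Orientation K) → oddVertices O ≤ 1 →
                      ∑[ v < n ] ⌈ outdeg O v /2⌉ + ∑[ v < n ] ⌈ outdeg O v /2⌉ ≤ numEdges K + 1
  ∑⌈outdeg/2⌉-bound O fewOdd = begin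
    ∑[ v < n ] ⌈ outdeg O v /2⌉ + ∑[ v < n ] ⌈ outdeg O v /2⌉  ≡⟨ ∑-distrib-+ (λ v → ⌈ outdeg O v /2⌉) _ ⟨
    ∑[ v < n ] (⌈ outdeg O v /2⌉ + ⌈ outdeg O v /2⌉)          ≡⟨ sum-cong-≗ {n} (⌈n/2⌉+⌈n/2⌉≡n+⟦odd-n⟧ ∘ outdeg O) ⟩
    ∑[ v < n ] (outdeg O v + ⟦ odd (outdeg O v) ⟧)             ≡⟨ ∑-distrib-+ (outdeg O) _ ⟩
    sum (outdeg O) + oddVertices O                             ≡⟨ cong (_+ oddVertices O) (numEdges≡∑outdeg O) ⟨
    numEdges K + oddVertices O                                 ≤⟨ +-monoʳ-≤ (numEdges K) fewOdd ⟩
    numEdges K + 1                                             ∎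
    where open ≤-Reasoning

evenOrientation : ∀ {n} {K : Graph n} → Connected K → Σ (Orientation K) λ O → oddVertices O ≤ 1
evenOrientation {zero}  connected = byIndex , z≤n
evenOrientation {suc n} connected with evenAwayFrom-all zero (connected zero) (allFin (suc n))
... | O , evens =
  O , ≤-trans (≤-reflexive (∑-single zero λ v v≢0 → cong ⟦_⟧ (All.lookup evens (∈-allFin v) v≢0))) (⟦b⟧≤1 _)

-- Minimum triangle-transversals leave G connected

CommonNeighbour : ∀ {n} → Graph n → Fin n → Fin n → Set
CommonNeighbour K v w = ∃ λ x → adj K v x ≡ true × adj K x w ≡ true

module _ {n} {G : Graph n} (F : EdgeSet G) where

  removeEdge : Fin n → Fin n → EdgeSet G
  removeEdge v w = record
    { mem = λ a b → mem F a b ∧ not (does (sameEdge? v w a b))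
    ; sym = λ a b → cong₂ (λ f s → f ∧ not s) (EdgeSet.sym F a b)
                          (does-⇔ (mk⇔ SameEdge-swap SameEdge-swap) (sameEdge? v w a b) (sameEdge? v w b a))
    ; sub = λ a b ab → sub F a b (x∧y≡true⇒x≡true ab)
    }

  removeEdge-adjMinus : ∀ {v w a b} → adjMinus G (removeEdge v w) a b → adjMinus G F a b ⊎ SameEdge v w a b
  removeEdge-adjMinus {v} {w} {a} {b} (ab , ¬F′ab) =
    Sum.map₁ (ab ,_) (kept-or-removed (mem F a b) (sameEdge? v w a b) ¬F′ab)
    where
    kept-or-removed : ∀ {P : Set} x (p : Dec P) → x ∧ not (does p) ≡ false → x ≡ false ⊎ P
    kept-or-removed x (yes p) _ = inj₂ p
    kept-or-removed x (no _)  e = inj₁ (trans (sym (∧-identityʳ x)) e)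

  esize-removeEdge : ∀ {v w} → adj G v w ≡ true → mem F v w ≡ true → esize (removeEdge v w) < esize F
  esize-removeEdge {v} {w} vw Fvw =
    countPairs-< (mem (removeEdge v w)) (mem F) (λ _ _ → x∧y≡true⇒x≡true) (EdgeSet.sym (removeEdge v w)) (EdgeSet.sym F)
                 (adj⇒≢ G vw) Fvw removed
    where
    removed : mem (removeEdge v w) v w ≡ false
    removed = trans (cong (λ s → mem F v w ∧ not s) (dec-true (sameEdge? v w v w) (inj₁ (refl , refl))))
                    (∧-zeroʳ (mem F v w))

  removeEdge-noApex : ∀ {v w a b c} → ¬ CommonNeighbour (G ∖ F) v w → SameEdge v w a b →
                      adjMinus G (removeEdge v w) a c → adjMinus G (removeEdge v w) b c → ⊥
  removeEdge-noApex {v} {w} {a} {b} {c} noCommon ab ac bc with removeEdge-adjMinus ac | removeEdge-adjMinus bc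
  ... | inj₂ ac′ | _        = adj⇒≢ G (proj₁ bc) (SameEdge-functional ab ac′)
  ... | inj₁ _   | inj₂ bc′ = adj⇒≢ G (proj₁ ac) (SameEdge-functional (SameEdge-swap ab) bc′)
  ... | inj₁ ac′ | inj₁ bc′ = noCommon (apex ab)
    where
    apex : SameEdge v w a b → CommonNeighbour (G ∖ F) v w
    apex (inj₁ (refl , refl)) = c , ∖-adj⁺ F ac′ , ∖-adj⁺ F (adjMinus-sym F bc′)
    apex (inj₂ (refl , refl)) = c , ∖-adj⁺ F bc′ , ∖-adj⁺ F (adjMinus-sym F ac′)

  removeEdge-transversal : ∀ {v w} → IsTriangleTransversal G F → ¬ CommonNeighbour (G ∖ F) v w →
                           IsTriangleTransversal G (removeEdge v w)
  removeEdge-transversal {v} {w} trF noCommon x y z xy yz xz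
    with removeEdge-adjMinus xy | removeEdge-adjMinus yz | removeEdge-adjMinus xz
  ... | inj₁ xy′ | inj₁ yz′ | inj₁ xz′ = trF x y z xy′ yz′ xz′
  ... | inj₂ s   | _        | _        = removeEdge-noApex noCommon s xz yz
  ... | inj₁ _   | inj₂ s   | _        = removeEdge-noApex noCommon s (adjMinus-sym (removeEdge v w) xy)
                                                                   (adjMinus-sym (removeEdge v w) xz)
  ... | inj₁ _   | inj₁ _   | inj₂ s   = removeEdge-noApex noCommon s xy (adjMinus-sym (removeEdge v w) yz)

  minimal⇒commonNeighbour : IsMinTriangleTransversal G F → ∀ {v w} → adj G v w ≡ true → mem F v w ≡ true →
                            CommonNeighbour (G ∖ F) v w
  minimal⇒commonNeighbour (trF , minimal) {v} {w} vw Fvw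
    with any? (λ x → (adj (G ∖ F) v x ≟ᵇ true) ×-dec (adj (G ∖ F) x w ≟ᵇ true))
  ... | yes common  = common
  ... | no noCommon =
    ⊥-elim (<⇒≱ (esize-removeEdge vw Fvw) (minimal (removeEdge v w) (removeEdge-transversal trF noCommon)))

  minimal⇒reach-∖ : IsMinTriangleTransversal G F → ∀ {u v} → Reach G u v → Reach (G ∖ F) u v
  minimal⇒reach-∖ minF here = here
  minimal⇒reach-∖ minF (step {v} {w} walk vw) with mem F v w in Fvw
  ... | false = step (minimal⇒reach-∖ minF walk) (∖-adj⁺ F (vw , Fvw))
  ... | true with minimal⇒commonNeighbour minF vw Fvw
  ...   | x , vx , xw = step (step (minimal⇒reach-∖ minF walk) vx) xw

-- Repairing an orientation star by star

module Reorientation {n} {G : Graph n} (O₂ : Orientation G) where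

  Agree : Orientation G → Fin n → Fin n → Set
  Agree O a b = dir O a b ≡ dir O₂ a b

  agree? : ∀ O a b → Dec (Agree O a b)
  agree? O a b = dir O a b ≟ᵇ dir O₂ a b

  agree-sym : ∀ {O a b} → adj G a b ≡ true → Agree O a b → Agree O b a
  agree-sym {O} ab agr = trans (dir-flip O ab) (trans (cong not agr) (sym (dir-flip O₂ ab)))

  disagree-sym : ∀ {O a b} → adj G a b ≡ true → ¬ Agree O a b → ¬ Agree O b a
  disagree-sym {O} {a} {b} ab ¬agr = ¬agr ∘ agree-sym {O} (trans (Graph.sym G b a) ab)

  invert-agree-inside : ∀ {X O a b} → adj G a b ≡ true → a ∈ X → b ∈ X → ¬ Agree O a b → Agree (invertO X O) a b
  invert-agree-inside {O = O} ab a∈X b∈X ¬agr =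
    trans (invert-inside a∈X b∈X (dir O)) (trans (dir-flip O ab) (sym (¬-not (¬agr ∘ sym))))

  invert-agree-outside : ∀ {X O a b} → ¬ (a ∈ X × b ∈ X) → Agree O a b → Agree (invertO X O) a b
  invert-agree-outside {O = O} ¬both agr = trans (invert-outside ¬both (dir O)) agr

  agreeOnEdges⇒≗ : ∀ {O} → (∀ a b → adj G a b ≡ true → Agree O a b) → ∀ a b → dir O a b ≡ dir O₂ a b
  agreeOnEdges⇒≗ {O} agr a b with adj G a b in ab
  ... | true  = agr a b ab
  ... | false = trans (dir-nonEdge O ab) (sym (dir-nonEdge O₂ ab))

  record _⊑⟨_⟩_ (O : Orientation G) (K : Graph n) (O′ : Orientation G) : Set where
    constructor keeping
    field kept : ∀ a b → adj K a b ≡ true → Agree O a b → Agree O′ a b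
  open _⊑⟨_⟩_ public

  Stable : Graph n → (Orientation G → Set) → Set
  Stable K P = ∀ {O O′} → O ⊑⟨ K ⟩ O′ → P O → P O′

  agreeOn-stable : ∀ {K} → Stable K (λ O → ∀ a b → adj K a b ≡ true → Agree O a b)
  agreeOn-stable O⊑O′ agr a b ab = kept O⊑O′ a b ab (agr a b ab)

  agreeAround-stable : ∀ {K v ws} → All (λ w → adj K v w ≡ true) ws → Stable K (λ O → All (Agree O v) ws)
  agreeAround-stable                  []           O⊑O′ []           = []
  agreeAround-stable {K} {v} {w ∷ ws} (v~w ∷ v~ws) O⊑O′ (agr ∷ agrs) =
    kept O⊑O′ v w v~w agr ∷ agreeAround-stable v~ws O⊑O′ agrs

  record Progress (K : Graph n) (k : ℕ) (P : Orientation G → Set) (O : Orientation G) : Set where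
    constructor progress
    field
      reached  : Orientation G
      steps    : TransformableIn 3 k O reached
      keeps    : O ⊑⟨ K ⟩ reached
      achieves : P reached
  open Progress public

  stay : ∀ {K P O} → P O → Progress K 0 P O
  stay {O = O} p = progress O (TransformableIn-refl {p = 3} {O = O}) (keeping λ _ _ _ → id) p

  Progress-map : ∀ {K k} {P Q : Orientation G → Set} {O} → (∀ {O′} → P O′ → Q O′) → Progress K k P O → Progress K k Q O
  Progress-map P⇒Q (progress O′ steps keeps p) = progress O′ steps keeps (P⇒Q p)

  Progress-cost : ∀ {K k l P O} → k ≡ l → Progress K k P O → Progress K l P O
  Progress-cost refl p = p

  restrict : ∀ {K L k P O} → K ⊆ᴳ L → Progress L k P O → Progress K k P O
  restrict K⊆L (progress O′ steps keeps p) = progress O′ steps (keeping λ a b ab → kept keeps a b (K⊆L ab)) p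

  then : ∀ {K k l P Q O} → Stable K P → Progress K k P O → (∀ O′ → Progress K l Q O′) →
         Progress K (k + l) (λ O″ → P O″ × Q O″) O
  then {O = O} P-stable (progress O′ steps₁ keeps₁ p) next with next O′
  ... | progress O″ steps₂ keeps₂ q =
    progress O″ (TransformableIn-trans {p = 3} {O = O} {O′} {O″} steps₁ steps₂)
             (keeping λ a b ab → kept keeps₂ a b ab ∘ kept keeps₁ a b ab) (P-stable keeps₂ p , q)

  sequence : ∀ {A : Set} {K} (cost : A → ℕ) {P : A → Orientation G → Set} xs →
             (∀ {x} → x ∈ˡ xs → Stable K (P x)) → (∀ {x} → x ∈ˡ xs → ∀ O → Progress K (cost x) (P x) O) →
             ∀ O → Progress K (List.sum (map cost xs)) (λ O′ → All (λ x → P x O′) xs) O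
  sequence cost []       P-stable fix O = stay []
  sequence cost (x ∷ xs) P-stable fix O =
    Progress-map (λ (p , ps) → p ∷ ps)
      (then (P-stable (here refl)) (fix (here refl) O) (sequence cost xs (P-stable ∘ there) (fix ∘ there)))

  complete : ∀ {K k O} → Progress K k (λ O′ → ∀ a b → adj G a b ≡ true → Agree O′ a b) O → TransformableIn 3 k O O₂
  complete {k = k} {O} (progress O′ steps _ agr) =
    TransformableIn-target {p = 3} {k = k} {O = O} {O′} {O₂} (agreeOnEdges⇒≗ {O′} agr) steps

  fixStar : ∀ {K} → K ⊆ᴳ G → ∀ v ws → length ws ≤ 2 → All (λ w → adj K v w ≡ true) ws →
            (∀ {a b} → a ∈ˡ ws → b ∈ˡ ws → ¬ adj K a b ≡ true) →
            ∀ O → Progress K 1 (λ O′ → All (Agree O′ v) ws) O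
  fixStar {K} K⊆G v ws |ws|≤2 v~ws ws≁ws O =
    progress (invertO S O) (TransformableIn-invert {p = 3} {X = S} |S|≤3 O) preserved (All.tabulate repaired)
    where
    wrong : List (Fin n)
    wrong = filter (¬? ∘ agree? O v) ws

    S : Subset n
    S = fromList (v ∷ wrong)

    |S|≤3 : ∣ S ∣ ≤ 3
    |S|≤3 = ≤-trans (∣fromList∣≤length (v ∷ wrong)) (s≤s (≤-trans (length-filter (¬? ∘ agree? O v) ws) |ws|≤2))

    member : ∀ {a} → a ∈ S → a ≡ v ⊎ (a ∈ˡ ws × ¬ Agree O v a)
    member a∈S with ∈-fromList⁻ (v ∷ wrong) a∈S
    ... | here a≡v      = inj₁ a≡v
    ... | there a∈wrong = inj₂ (∈-filter⁻ (¬? ∘ agree? O v) a∈wrong)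

    disagreeInside : ∀ {a b} → a ∈ S → b ∈ S → adj K a b ≡ true → ¬ Agree O a b
    disagreeInside a∈S b∈S ab with member a∈S | member b∈S
    ... | inj₁ refl       | inj₁ refl       = ⊥-elim (adj⇒≢ K ab refl)
    ... | inj₁ refl       | inj₂ (_ , ¬agr) = ¬agr
    ... | inj₂ (_ , ¬agr) | inj₁ refl       = disagree-sym {O} (K⊆G (trans (Graph.sym K _ _) ab)) ¬agr
    ... | inj₂ (a∈ws , _) | inj₂ (b∈ws , _) = ⊥-elim (ws≁ws a∈ws b∈ws ab)

    preserved : O ⊑⟨ K ⟩ invertO S O
    kept preserved a b ab agr = invert-agree-outside {S} {O} (λ (a∈S , b∈S) → disagreeInside a∈S b∈S ab agr) agr

    repaired : ∀ {w} → w ∈ˡ ws → Agree (invertO S O) v w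
    repaired {w} w∈ws with agree? O v w
    ... | yes agr = kept preserved v w (All.lookup v~ws w∈ws) agr
    ... | no ¬agr = invert-agree-inside {S} {O} (K⊆G (All.lookup v~ws w∈ws))
                      (∈-fromList⁺ (v ∷ wrong) (here refl))
                      (∈-fromList⁺ (v ∷ wrong) (there (∈-filter⁺ (¬? ∘ agree? O v) w∈ws ¬agr))) ¬agr

  fixStarByPairs : ∀ {K} → K ⊆ᴳ G → TriangleFree K → ∀ v ws → All (λ w → adj K v w ≡ true) ws →
                   ∀ O → Progress K ⌈ length ws /2⌉ (λ O′ → All (Agree O′ v) ws) O
  fixStarByPairs         K⊆G △-free v []             []                    O = stay []
  fixStarByPairs {K}     K⊆G △-free v (w ∷ [])       v~ws                  O =
    fixStar K⊆G v (w ∷ []) (s≤s z≤n) v~ws (neighbours-nonadjacent {K = K} △-free v~ws) O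
  fixStarByPairs {K}     K⊆G △-free v (w₁ ∷ w₂ ∷ ws) (v~w₁ ∷ v~w₂ ∷ v~ws) O =
    Progress-map (λ (agr₁ , agr₂) → ++⁺ agr₁ agr₂)
      (then (agreeAround-stable (v~w₁ ∷ v~w₂ ∷ []))
            (fixStar K⊆G v (w₁ ∷ w₂ ∷ []) ≤-refl (v~w₁ ∷ v~w₂ ∷ [])
                     (neighbours-nonadjacent {K = K} △-free (v~w₁ ∷ v~w₂ ∷ [])) O)
            (fixStarByPairs K⊆G △-free v ws v~ws))

  outNeighbours : ∀ {K : Graph n} → Orientation K → Fin n → List (Fin n)
  outNeighbours O v = filter (T? ∘ dir O v) (allFin n)

  length-outNeighbours : ∀ {K : Graph n} (O : Orientation K) v → length (outNeighbours O v) ≡ outdeg O v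
  length-outNeighbours O v = trans (length-filter-T? (dir O v) (allFin n)) (sum-map-allFin (⟦_⟧ ∘ dir O v))

  outNeighbours-adj : ∀ {K : Graph n} (O : Orientation K) v → All (λ w → adj K v w ≡ true) (outNeighbours O v)
  outNeighbours-adj O v =
    All.tabulate λ w∈ → onEdges O v _ (Equivalence.to T-≡ (proj₂ (∈-filter⁻ (T? ∘ dir O v) {xs = allFin n} w∈)))

  ∈-outNeighbours : ∀ {K : Graph n} (O : Orientation K) {v w} → dir O v w ≡ true → w ∈ˡ outNeighbours O v
  ∈-outNeighbours O {v} {w} vw = ∈-filter⁺ (T? ∘ dir O v) (∈-allFin w) (Equivalence.from T-≡ vw)

  fixStars : (F : EdgeSet G) → TriangleFree (G ∖ F) → (Oₕ : Orientation (G ∖ F)) →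
             ∀ O → Progress (G ∖ F) (∑[ v < n ] ⌈ outdeg Oₕ v /2⌉) (λ O′ → ∀ a b → adj (G ∖ F) a b ≡ true → Agree O′ a b) O
  fixStars F △-free Oₕ O =
    Progress-cost cost
      (Progress-map (λ {O′} → agreeOnH {O′})
        (sequence (λ v → ⌈ length (outNeighbours Oₕ v) /2⌉) (allFin n)
          (λ {v} _ → agreeAround-stable (outNeighbours-adj Oₕ v))
          (λ {v} _ → fixStarByPairs (∖⊆ F) △-free v (outNeighbours Oₕ v) (outNeighbours-adj Oₕ v))
          O))
    where
    cost : List.sum (map (λ v → ⌈ length (outNeighbours Oₕ v) /2⌉) (allFin n)) ≡ ∑[ v < n ] ⌈ outdeg Oₕ v /2⌉
    cost = trans (sum-map-allFin {n} _) (sum-cong-≗ {n} (λ v → cong ⌈_/2⌉ (length-outNeighbours Oₕ v)))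
    agreeOnH : ∀ {O′} → All (λ v → All (Agree O′ v) (outNeighbours Oₕ v)) (allFin n) →
               ∀ a b → adj (G ∖ F) a b ≡ true → Agree O′ a b
    agreeOnH {O′} agr a b ab with dir Oₕ a b in a→b
    ... | true  = All.lookup (All.lookup agr (∈-allFin a)) (∈-outNeighbours Oₕ a→b)
    ... | false = agree-sym {O′} (∖⊆ F (trans (Graph.sym (G ∖ F) b a) ab))
                    (All.lookup (All.lookup agr (∈-allFin b)) (∈-outNeighbours Oₕ (trans (dir-flip Oₕ ab) (cong not a→b))))

  fixTransversal : (F : EdgeSet G) → ∀ O → Progress G (esize F) (λ O′ → ∀ a b → mem F a b ≡ true → Agree O′ a b) O
  fixTransversal F O =
    Progress-cost (sum-map-const edges)
      (Progress-map (λ {O′} → agreeOnF {O′})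
        (sequence (λ _ → 1) edges
          (λ {(u , w)} uw∈ O⊑O′ → kept O⊑O′ u w (edge uw∈))
          (λ {(u , w)} uw∈ O → Progress-map (λ {O′} → All.head {P = Agree O′ u})
                                  (fixStar id u (w ∷ []) (s≤s z≤n) (edge uw∈ ∷ []) loopless O))
          O))
    where
    allPairs : List (Fin n × Fin n)
    allPairs = cartesianProduct (allFin n) (allFin n)

    -- the list counted by esize F, so that this phase costs esize F by definition
    edges : List (Fin n × Fin n)
    edges = filter (λ p → T? (proj₁ p <ᶠ proj₂ p ∧ mem F (proj₁ p) (proj₂ p))) allPairs

    sum-map-const : ∀ {A : Set} (xs : List A) → List.sum (map (λ _ → 1) xs) ≡ length xs
    sum-map-const []       = refl
    sum-map-const (x ∷ xs) = cong suc (sum-map-const xs)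

    edge : ∀ {u w} → (u , w) ∈ˡ edges → adj G u w ≡ true
    edge {u} {w} uw∈ =
      sub F u w (Equivalence.to T-≡ (proj₂ (Equivalence.to T-∧ (proj₂ (∈-filter⁻ _ {xs = allPairs} uw∈)))))

    ∈-edges : ∀ {u w} → u <ᶠ w ≡ true → mem F u w ≡ true → (u , w) ∈ˡ edges
    ∈-edges {u} {w} u<w uw =
      ∈-filter⁺ _ (∈-cartesianProduct⁺ (∈-allFin u) (∈-allFin w)) (Equivalence.from T-≡ (cong₂ _∧_ u<w uw))

    loopless : ∀ {w a b} → a ∈ˡ w ∷ [] → b ∈ˡ w ∷ [] → ¬ adj G a b ≡ true
    loopless (here refl) (here refl) ab = adj⇒≢ G ab refl

    agreeOnF : ∀ {O′} → All (λ p → Agree O′ (proj₁ p) (proj₂ p)) edges → ∀ a b → mem F a b ≡ true → Agree O′ a b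
    agreeOnF {O′} agr a b ab with a <ᶠ b in a<b
    ... | true  = All.lookup agr (∈-edges a<b ab)
    ... | false = agree-sym {O′} (sub F b a ba) (All.lookup agr (∈-edges b<a ba))
      where
      ba : mem F b a ≡ true
      ba = trans (EdgeSet.sym F b a) ab
      b<a : b <ᶠ a ≡ true
      b<a = trans (<ᶠ-flip (adj⇒≢ G (sub F a b ab))) (cong not a<b)

reorient : ∀ {n} {G : Graph n} (F : EdgeSet G) → IsTriangleTransversal G F → (Oₕ : Orientation (G ∖ F)) →
           (O₁ O₂ : Orientation G) → TransformableIn 3 (∑[ v < n ] ⌈ outdeg Oₕ v /2⌉ + esize F) O₁ O₂
reorient {G = G} F trF Oₕ O₁ O₂ =
  complete (Progress-map (λ {O} → agreeOnG {O})
    (then agreeOn-stable (fixStars F (transversal⇒triangleFree F trF) Oₕ O₁) (restrict (∖⊆ F) ∘ fixTransversal F)))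
  where
  open Reorientation O₂
  agreeOnG : ∀ {O} → (∀ a b → adj (G ∖ F) a b ≡ true → Agree O a b) × (∀ a b → mem F a b ≡ true → Agree O a b) →
             ∀ a b → adj G a b ≡ true → Agree O a b
  agreeOnG (onH , onF) a b ab with mem F a b in Fab
  ... | true  = onF a b Fab
  ... | false = onH a b (∖-adj⁺ F (ab , Fab))

k+e≤⌈[m+e]/2⌉ : ∀ {k e h m} → k + k ≤ h + 1 → m ≡ h + e → k + e ≤ ⌈ (m + e) /2⌉
k+e≤⌈[m+e]/2⌉ {k} {e} {h} k+k≤h+1 refl = begin
  k + e                        ≡⟨ n≡⌊n+n/2⌋ (k + e) ⟩
  ⌊ (k + e) + (k + e) /2⌋      ≤⟨ ⌊n/2⌋-mono (begin
      (k + e) + (k + e)        ≡⟨ regroupˡ k e ⟩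
      (k + k) + (e + e)        ≤⟨ +-monoˡ-≤ (e + e) k+k≤h+1 ⟩
      (h + 1) + (e + e)        ≡⟨ regroupʳ h e ⟩
      suc ((h + e) + e)        ∎) ⟩
  ⌈ (h + e) + e /2⌉            ∎
  where
  open ≤-Reasoning
  regroupˡ : ∀ k e → (k + e) + (k + e) ≡ (k + k) + (e + e)
  regroupˡ = solve-∀
  regroupʳ : ∀ h e → (h + 1) + (e + e) ≡ suc ((h + e) + e)
  regroupʳ = solve-∀

lemma16 : ∀ {n} (G : Graph n) → Connected G → (F : EdgeSet G) → IsMinTriangleTransversal G F
            → InvDiamLe G 3 ⌈ (numEdges G + esize F) /2⌉
lemma16 G connected F minimal O₁ O₂ with evenOrientation {K = G ∖ F} (λ u v → minimal⇒reach-∖ F minimal (connected u v))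
... | Oₕ , fewOdd =
  TransformableIn-weaken {O = O₁} {O₂} (k+e≤⌈[m+e]/2⌉ (∑⌈outdeg/2⌉-bound Oₕ fewOdd) (numEdges-∖ F))
    (reorient F (proj₁ minimal) Oₕ O₁ O₂)
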